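{- Let $\mathcal C$ be a collection of subsets of a set $X$ such that $X\in\mathcal C$ and $\mathcal C$ is closed under finite intersections. The following are equivalent: (a) $\mathcal C$ is Noetherian; (b) for every ultrafilter $\mathcal U$ on $X$, the set $\mathcal U\cap\mathcal C$ has a minimal element with respect to inclusion; (c) every ultrafilter $\mathcal U$ on $X$ contains a set $Y$ (not necessarily in $\mathcal C$) which is contained in every element of $\mathcal U\cap\mathcal C$.
   Context: A collection $\mathcal C$ of subsets of $X$ is Noetherian if it contains $X$, is closed under finite intersections, and has the descending chain condition: every descending chain $C_0\supseteq C_1\supseteq\cdots$ of elements of $\mathcal C$ eventually stabilises. -}

module Defs where

open import Level using (0ℓ)
open import Data.Nat using (ℕ; suc; _≤_)
open import Data.Product using (Σ; Σ-syntax; ∃; _×_)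
open import Relation.Nullary using (¬_)
open import Relation.Unary using (Pred; _⊆_; _≐_; _∩_; ∁; ∅; U)

Subset : Set → Set₁
Subset X = Pred X 0ℓ

Collection : Set → Set₁
Collection X = Pred (Subset X) 0ℓ

record Filter (X : Set) : Set₁ where
  field
    mem      : Collection X
    top      : mem U
    proper   : ¬ mem ∅
    inter    : ∀ {A B} → mem A → mem B → mem (A ∩ B)
    upward   : ∀ {A B} → A ⊆ B → mem A → mem B

record Ultrafilter (X : Set) : Set₁ where
  field
    filter : Filter X
  open Filter filter public
  field
    ultra : ∀ (A : Subset X) → ¬ mem A → mem (∁ A)

ContainsTop : {X : Set} → Collection X → Set
ContainsTop 𝒞 = 𝒞 U

InterClosed : {X : Set} → Collection X → Set₁
InterClosed {X} 𝒞 = ∀ {A B : Subset X} → 𝒞 A → 𝒞 B → 𝒞 (A ∩ B)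

DCC : {X : Set} → Collection X → Set₁
DCC {X} 𝒞 =
  ∀ (c : ℕ → Subset X) → (∀ n → 𝒞 (c n)) → (∀ n → c (suc n) ⊆ c n) →
  ∃ λ n → ∀ m → n ≤ m → c m ≐ c n

Noetherian : {X : Set} → Collection X → Set₁
Noetherian 𝒞 = ContainsTop 𝒞 × InterClosed 𝒞 × DCC 𝒞

IsMinimalIn : {X : Set} → Collection X → Subset X → Set₁
IsMinimalIn {X} 𝒟 M = 𝒟 M × (∀ (N : Subset X) → 𝒟 N → N ⊆ M → M ⊆ N)

_∩ᶜ_ : {X : Set} → Collection X → Collection X → Collection X
(𝒰 ∩ᶜ 𝒞) A = 𝒰 A × 𝒞 A

HasMinimals : {X : Set} → Collection X → Set₁
HasMinimals {X} 𝒞 =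
  ∀ (𝒰 : Ultrafilter X) → Σ[ M ∈ Subset X ] IsMinimalIn (Ultrafilter.mem 𝒰 ∩ᶜ 𝒞) M

HasLowerBoundInU : {X : Set} → Collection X → Set₁
HasLowerBoundInU {X} 𝒞 =
  ∀ (𝒰 : Ultrafilter X) → Σ[ Y ∈ Subset X ]
    (Ultrafilter.mem 𝒰 Y × (∀ (N : Subset X) → Ultrafilter.mem 𝒰 N → 𝒞 N → Y ⊆ N))

-- Ambient classical axiom (ZFC): ultrafilter lemma, every filter extends to an ultrafilter
UltrafilterLemma : Set₁
UltrafilterLemma = ∀ (X : Set) (F : Filter X) →
  Σ[ 𝒰 ∈ Ultrafilter X ] (∀ A → Filter.mem F A → Ultrafilter.mem 𝒰 A)

-- (a)⇒(b): if 𝒰 ∩ 𝒞 had no minimal element, choosing strictly smaller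
-- members of it over and over would give a strictly descending chain in 𝒞.
-- (b)⇒(c): a minimal element M of 𝒰 ∩ 𝒞 lies below every N ∈ 𝒰 ∩ 𝒞, since
-- M ∩ N is again in 𝒰 ∩ 𝒞.
-- (c)⇒(a): if a descending chain (cₙ) in 𝒞 never stabilises, no cₙ is
-- contained in I = ⋂ cₙ, so the sets cₙ ∖ I generate a proper filter. An
-- ultrafilter extending it contains every cₙ and ∁ I, so the set Y given by
-- (c) lies inside I and meets ∁ I, which is absurd.
module Submission where

open import Defs
open import Level using (0ℓ; suc)
open import Axiom.ExcludedMiddle using (ExcludedMiddle)
open import Axiom.DoubleNegationElimination using (em⇒dne)
open import Data.Nat using (ℕ; zero; _≤_; _≤′_; ≤′-refl; ≤′-step; _⊔_) renaming (suc to 1+)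
open import Data.Nat.Properties using (≤⇒≤′; m≤m⊔n; m≤n⊔m; n≤1+n)
open import Data.Product using (Σ; Σ-syntax; ∃; _×_; _,_; proj₁; proj₂)
open import Data.Empty using (⊥-elim)
open import Data.Sum using (_⊎_; inj₁; inj₂)
open import Relation.Nullary using (¬_; yes; no)
open import Relation.Unary using (_⊆_; _⊂_; _≐_; _∩_; ∁; ⋂)

module _ {X : Set} where

  EventuallyConstant : (ℕ → Subset X) → Set
  EventuallyConstant c = ∃ λ n → ∀ m → n ≤ m → c m ≐ c n

  module DescendingChain (c : ℕ → Subset X) (descending : ∀ n → c (1+ n) ⊆ c n) where

    antitone : ∀ {m n} → m ≤ n → c n ⊆ c m
    antitone m≤n = antitone′ (≤⇒≤′ m≤n)
      where
      antitone′ : ∀ {m n} → m ≤′ n → c n ⊆ c m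
      antitone′ ≤′-refl        = λ x∈cₙ → x∈cₙ
      antitone′ (≤′-step m≤′n) = λ x∈cₙ₊₁ → antitone′ m≤′n (descending _ x∈cₙ₊₁)

    ⊆⋂⇒eventuallyConstant : ∀ {n} → c n ⊆ ⋂ ℕ c → EventuallyConstant c
    ⊆⋂⇒eventuallyConstant {n} cₙ⊆⋂ = n , λ m n≤m → antitone n≤m , λ x∈cₙ → cₙ⊆⋂ x∈cₙ m

    tail : ℕ → Subset X
    tail n = c n ∩ ∁ (⋂ ℕ c)

    tailFilter : ExcludedMiddle 0ℓ → ¬ EventuallyConstant c → Filter X
    tailFilter em ¬const = record
      { mem    = λ A → ∃ λ n → tail n ⊆ A
      ; top    = 0 , λ _ → _
      ; proper = λ (n , tailₙ⊆∅) →
          ¬const (⊆⋂⇒eventuallyConstant λ x∈cₙ → em⇒dne em λ x∉⋂ → tailₙ⊆∅ (x∈cₙ , x∉⋂))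
      ; inter  = λ (m , tailₘ⊆A) (n , tailₙ⊆B) → m ⊔ n , λ (x∈c , x∉⋂) →
          tailₘ⊆A (antitone (m≤m⊔n m n) x∈c , x∉⋂) , tailₙ⊆B (antitone (m≤n⊔m m n) x∈c , x∉⋂)
      ; upward = λ A⊆B (n , tailₙ⊆A) → n , λ x∈tail → A⊆B (tailₙ⊆A x∈tail)
      }

  strictlyDescending⇒¬DCC : {𝒞 : Collection X} (c : ℕ → Subset X) → (∀ n → 𝒞 (c n)) →
                            (∀ n → c (1+ n) ⊂ c n) → ¬ DCC 𝒞
  strictlyDescending⇒¬DCC c c∈𝒞 strict dcc with dcc c c∈𝒞 (λ n → proj₁ (strict n))
  ... | n , constant = proj₂ (strict n) (proj₂ (constant (1+ n) (n≤1+n n)))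

  module _ {𝒟 : Collection X} where

    strictlySmaller⇒strictlyDescendingChain : ∀ {M₀} → 𝒟 M₀ →
      (∀ {M} → 𝒟 M → Σ[ N ∈ Subset X ] (𝒟 N × N ⊂ M)) →
      Σ[ c ∈ (ℕ → Subset X) ] ((∀ n → 𝒟 (c n)) × (∀ n → c (1+ n) ⊂ c n))
    strictlySmaller⇒strictlyDescendingChain {M₀} M₀∈𝒟 smaller =
      (λ n → proj₁ (chain n)) , (λ n → proj₂ (chain n)) , (λ n → proj₂ (proj₂ (smaller (proj₂ (chain n)))))
      where
      chain : ℕ → Σ (Subset X) 𝒟
      chain zero   = M₀ , M₀∈𝒟
      chain (1+ n) = proj₁ (smaller (proj₂ (chain n))) , proj₁ (proj₂ (smaller (proj₂ (chain n))))

    module _ (em₀ : ExcludedMiddle 0ℓ) (em₁ : ExcludedMiddle (suc 0ℓ)) where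

      minimal⊎strictlySmaller : ∀ {M} → 𝒟 M → IsMinimalIn 𝒟 M ⊎ Σ[ N ∈ Subset X ] (𝒟 N × N ⊂ M)
      minimal⊎strictlySmaller {M} M∈𝒟 with em₁ {Σ[ N ∈ Subset X ] (𝒟 N × N ⊂ M)}
      ... | yes smaller = inj₂ smaller
      ... | no ¬smaller = inj₁ (M∈𝒟 , λ N N∈𝒟 N⊆M →
            em⇒dne em₀ λ M⊈N → ¬smaller (N , N∈𝒟 , N⊆M , M⊈N))

      DCC⇒minimal : {𝒞 : Collection X} → DCC 𝒞 → 𝒟 ⊆ 𝒞 → ∀ {M₀} → 𝒟 M₀ →
                    Σ[ M ∈ Subset X ] IsMinimalIn 𝒟 M
      DCC⇒minimal {𝒞} dcc 𝒟⊆𝒞 M₀∈𝒟 with em₁ {Σ[ M ∈ Subset X ] IsMinimalIn 𝒟 M}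
      ... | yes minimal = minimal
      ... | no ¬minimal =
        let c , c∈𝒟 , strict = strictlySmaller⇒strictlyDescendingChain M₀∈𝒟 smaller
        in ⊥-elim (strictlyDescending⇒¬DCC {𝒞 = 𝒞} c (λ n → 𝒟⊆𝒞 (c∈𝒟 n)) strict dcc)
        where
        smaller : ∀ {M} → 𝒟 M → Σ[ N ∈ Subset X ] (𝒟 N × N ⊂ M)
        smaller {M} M∈𝒟 with minimal⊎strictlySmaller M∈𝒟
        ... | inj₁ M-minimal = ⊥-elim (¬minimal (M , M-minimal))
        ... | inj₂ N-smaller = N-smaller

    minimal⇒least : InterClosed 𝒟 → ∀ {M N} → IsMinimalIn 𝒟 M → 𝒟 N → M ⊆ N
    minimal⇒least ∩-closed {M} {N} (M∈𝒟 , minimal) N∈𝒟 x∈M =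
      proj₂ (minimal (M ∩ N) (∩-closed M∈𝒟 N∈𝒟) proj₁ x∈M)

  filter∩ᶜ-interClosed : (F : Filter X) {𝒞 : Collection X} → InterClosed 𝒞 →
                         InterClosed (Filter.mem F ∩ᶜ 𝒞)
  filter∩ᶜ-interClosed F ∩-closed (A∈F , A∈𝒞) (B∈F , B∈𝒞) =
    Filter.inter F A∈F B∈F , ∩-closed A∈𝒞 B∈𝒞

  module _ (F : Filter X) where
    open Filter F

    ∁-∉ : ∀ {A} → mem A → ¬ mem (∁ A)
    ∁-∉ A∈F ∁A∈F = proper (upward (λ (x∈A , x∉A) → x∉A x∈A) (inter A∈F ∁A∈F))

    lowerBound⇒⋂∈ : {𝒞 : Collection X} {Y : Subset X} → mem Y →
                    (∀ N → mem N → 𝒞 N → Y ⊆ N) →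
                    (c : ℕ → Subset X) → (∀ n → mem (c n)) → (∀ n → 𝒞 (c n)) → mem (⋂ ℕ c)
    lowerBound⇒⋂∈ Y∈F Y-lower c c∈F c∈𝒞 =
      upward (λ y∈Y n → Y-lower (c n) (c∈F n) (c∈𝒞 n) y∈Y) Y∈F

  lowerBoundInU⇒DCC : ExcludedMiddle 0ℓ → UltrafilterLemma →
                      {𝒞 : Collection X} → HasLowerBoundInU 𝒞 → DCC 𝒞
  lowerBoundInU⇒DCC em ultrafilterLemma lowerBound c c∈𝒞 descending
    with em {EventuallyConstant c}
  ... | yes constant = constant
  ... | no ¬constant with ultrafilterLemma X (DescendingChain.tailFilter c descending em ¬constant)
  ... | 𝒰 , tails⊆𝒰 with lowerBound 𝒰
  ... | _ , Y∈𝒰 , Y-lower = ⊥-elim (∁-∉ F (lowerBound⇒⋂∈ F Y∈𝒰 Y-lower c c∈𝒰 c∈𝒞) ∁⋂∈𝒰)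
    where
    F : Filter X
    F = Ultrafilter.filter 𝒰
    c∈𝒰 : ∀ n → Ultrafilter.mem 𝒰 (c n)
    c∈𝒰 n = tails⊆𝒰 (c n) (n , proj₁)
    ∁⋂∈𝒰 : Ultrafilter.mem 𝒰 (∁ (⋂ ℕ c))
    ∁⋂∈𝒰 = tails⊆𝒰 (∁ (⋂ ℕ c)) (0 , proj₂)

lemma2p2 : ExcludedMiddle 0ℓ → ExcludedMiddle (suc 0ℓ) → UltrafilterLemma →
    (X : Set) (𝒞 : Collection X) → ContainsTop 𝒞 → InterClosed 𝒞 →
    (Noetherian 𝒞 → HasMinimals 𝒞) × (HasMinimals 𝒞 → HasLowerBoundInU 𝒞) ×
    (HasLowerBoundInU 𝒞 → Noetherian 𝒞)
lemma2p2 em₀ em₁ ultrafilterLemma X 𝒞 U∈𝒞 ∩-closed = a⇒b , b⇒c , c⇒a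
  where
  a⇒b : Noetherian 𝒞 → HasMinimals 𝒞
  a⇒b (_ , _ , dcc) 𝒰 = DCC⇒minimal em₀ em₁ dcc proj₂ (Ultrafilter.top 𝒰 , U∈𝒞)

  b⇒c : HasMinimals 𝒞 → HasLowerBoundInU 𝒞
  b⇒c minimal 𝒰 =
    let M , M-minimal = minimal 𝒰
        𝒰∩𝒞-closed = filter∩ᶜ-interClosed (Ultrafilter.filter 𝒰) ∩-closed
    in M , proj₁ (proj₁ M-minimal) , λ N N∈𝒰 N∈𝒞 → minimal⇒least 𝒰∩𝒞-closed M-minimal (N∈𝒰 , N∈𝒞)

  c⇒a : HasLowerBoundInU 𝒞 → Noetherian 𝒞
  c⇒a lowerBound = U∈𝒞 , ∩-closed , lowerBoundInU⇒DCC em₀ ultrafilterLemma lowerBound
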